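{- $D(19,\{3,4\})\ge 33$; equivalently, every $\{K_3,K_4\}$-decomposition of $K_{19}$ contains at least $9$ copies of $K_3$.
   Context: A $\{K_3,K_4\}$-decomposition of $K_v$ is a collection of subgraphs of $K_v$, each isomorphic to $K_3$ or $K_4$, whose edge sets partition $E(K_v)$. $D(v,\{3,4\})$ denotes the minimum number of subgraphs in a $\{K_3,K_4\}$-decomposition of $K_v$. -}

module Defs where

open import Data.Nat using (ℕ)
open import Data.Fin using (Fin)
open import Data.List using (List; length; filter)
open import Data.List.Membership.Propositional using (_∈_)
open import Data.List.Membership.DecPropositional using () renaming (_∈?_ to ∈?-gen)
open import Data.List.Relation.Unary.Unique.Propositional using (Unique)
open import Data.Fin.Properties using (_≟_)
open import Data.Product using (_×_)
open import Data.Sum using (_⊎_)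
open import Relation.Binary.PropositionalEquality using (_≡_)
open import Relation.Nullary using (¬_)
open import Relation.Nullary.Decidable using (_×-dec_)

-- A complete subgraph of K_v on the vertex set Fin v is determined by its
-- vertex set; we represent a copy of K_3 or K_4 by a duplicate-free list of
-- 3 or 4 vertices (its edges are all pairs of distinct listed vertices).
record Block (v : ℕ) : Set where
  constructor block
  field
    verts  : List (Fin v)
    unique : Unique verts
    size   : length verts ≡ 3 ⊎ length verts ≡ 4

open Block public

coverCount : ∀ {v} → List (Block v) → Fin v → Fin v → ℕ
coverCount {v} bs x y =
  length (filter (λ b → ∈?-gen _≟_ x (verts b) ×-dec ∈?-gen _≟_ y (verts b)) bs)

IsK34Decomposition : ∀ {v} → List (Block v) → Set
IsK34Decomposition {v} bs = (x y : Fin v) → ¬ x ≡ y → coverCount bs x y ≡ 1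

{-# OPTIONS --safe #-}
module Submission where

-- The blocks through a vertex x partition the other 18 vertices, so if x lies on r₃ triangles
-- and r₄ copies of K₄ then 2 r₃ + 3 r₄ = 18, whence 3 ∣ r₃. Summing over x gives t + 2f = 57
-- for the numbers t of triangles and f of K₄'s, so there are (t + 57)/2 blocks and it suffices
-- to exclude t ≤ 7. The triangles through a vertex on some triangle reach 2 r₃ ≥ 6 further such
-- vertices, while 3 ∣ r₃ leaves room for at most t of them; so t ≥ 7 (t = 0 is excluded by
-- parity). If t = 7 there are exactly 7 such vertices, each on 3 triangles and 4 K₄'s, and any
-- two of them lie on a common triangle, so no K₄ contains two of them. Writing m for the number
-- of them in a K₄, summing over the K₄'s gives Σ m = Σ m² = 28, and 2m ≤ m² + 1 then yields
-- 56 ≤ 28 + f = 53.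

open import Defs
open import Data.Nat using (_≤_)
open import Data.List using (List; length)

open import Data.Bool using (true; false; if_then_else_)
open import Data.Empty using (⊥; ⊥-elim)
open import Data.Fin using (Fin; zero; suc; punchIn; punchOut)
open import Data.Fin.Properties using (_≟_; ¬∀⟶∃¬; punchInᵢ≢i; punchIn-punchOut)
open import Data.List using ([]; _∷_; filter; lookup)
open import Data.List.Membership.DecPropositional using () renaming (_∈?_ to ∈?-gen)
open import Data.List.Relation.Unary.All.Properties using (All¬⇒¬Any)
open import Data.List.Relation.Unary.AllPairs using ([]; _∷_)
open import Data.List.Relation.Unary.Unique.Propositional using (Unique)
open import Data.Nat as ℕ using (ℕ; zero; suc; _+_; _*_; _⊓_; _<_; z≤n; s≤s; ≢-nonZero)
open import Data.Nat.Coprimality using (coprime?; coprime-divisor)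
open import Data.Nat.Divisibility using (_∣_; _∣?_; divides; ∣⇒≤; ∣m+n∣m⇒∣n; m∣m*n)
open import Data.Nat.Properties hiding (_≟_)
open import Data.Nat.Tactic.RingSolver using (solve-∀)
open import Data.Product using (∃; proj₂)
open import Data.Sum using (inj₁; inj₂; [_,_])
open import Data.Vec.Functional using (removeAt)
open import Function using (_∘_; const)
open import Relation.Binary.PropositionalEquality
  using (_≡_; _≢_; _≗_; refl; sym; trans; cong; cong₂; subst; module ≡-Reasoning)
open import Relation.Nullary using (¬_; Dec; yes; no; does; _because_)
open import Relation.Nullary.Decidable using (from-yes; from-no; _×-dec_)
open import Relation.Unary using (Decidable)

open import Algebra.Properties.Semiring.Sum +-*-semiring
  using (sum; sum-syntax; sum-cong-≗; sum-remove; sum-replicate-zero; ∑-distrib-+; ∑-comm;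
         *-distribˡ-sum; *-distribʳ-sum)
open import Algebra.Properties.CommutativeSemigroup *-commutativeSemigroup using (x∙yz≈y∙xz)

2*m≤m*m+1 : ∀ m → 2 * m ≤ m * m + 1
2*m≤m*m+1 zero    = z≤n
2*m≤m*m+1 (suc m) = subst (2 * suc m ≤_) (expand m) (m≤m+n (2 * suc m) (m * m))
  where
  expand : ∀ m → 2 * suc m + m * m ≡ suc m * suc m + 1
  expand = solve-∀

1⊓-idem : ∀ m → (1 ⊓ m) * (1 ⊓ m) ≡ 1 ⊓ m
1⊓-idem zero    = refl
1⊓-idem (suc m) = refl

1⊓-nonzero : ∀ {m} → m ≢ 0 → 1 ⊓ m ≡ 1
1⊓-nonzero {zero}  m≢0 = ⊥-elim (m≢0 refl)
1⊓-nonzero {suc m} _   = refl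

1⊓-*-cong : ∀ m {a b} → (m ≢ 0 → a ≡ b) → (1 ⊓ m) * a ≡ (1 ⊓ m) * b
1⊓-*-cong zero    _   = refl
1⊓-*-cong (suc m) a≡b = cong (1 *_) (a≡b (λ ()))

∣⇒*[1⊓]≤ : ∀ {d m} → d ∣ m → d * (1 ⊓ m) ≤ m
∣⇒*[1⊓]≤ {d} {zero}  _   = ≤-reflexive (*-zeroʳ d)
∣⇒*[1⊓]≤ {d} {suc m} d∣m = ≤-trans (≤-reflexive (*-identityʳ d)) (∣⇒≤ d∣m)

sum-zero : ∀ {n} {f : Fin n → ℕ} → (∀ i → f i ≡ 0) → sum f ≡ 0
sum-zero {n} f≗0 = trans (sum-cong-≗ f≗0) (sum-replicate-zero n)

∑-const : ∀ n c → ∑[ i < n ] c ≡ n * c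
∑-const zero    c = refl
∑-const (suc n) c = cong (c +_) (∑-const n c)

∃-nonzero : ∀ {n} (f : Fin n → ℕ) → sum f ≢ 0 → ∃ λ i → f i ≢ 0
∃-nonzero {n} f ∑f≢0 = ¬∀⟶∃¬ n _ (λ i → f i ℕ.≟ 0) (∑f≢0 ∘ sum-zero)

sum-mono-≤ : ∀ {n} {f g : Fin n → ℕ} → (∀ i → f i ≤ g i) → sum f ≤ sum g
sum-mono-≤ {zero}  f≤g = z≤n
sum-mono-≤ {suc n} f≤g = +-mono-≤ (f≤g zero) (sum-mono-≤ (f≤g ∘ suc))

sum-mono-≤-tight : ∀ {n} {f g : Fin n → ℕ} → (∀ i → f i ≤ g i) → sum g ≤ sum f → f ≗ g
sum-mono-≤-tight {suc n} {f} {g} f≤g ∑g≤∑f i = ≤-antisym (f≤g i) (+-cancelʳ-≤ _ _ _ (begin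
  g i + sum (removeAt g i)  ≡⟨ sum-remove g ⟨
  sum g                     ≤⟨ ∑g≤∑f ⟩
  sum f                     ≡⟨ sum-remove f ⟩
  f i + sum (removeAt f i)  ≤⟨ +-monoʳ-≤ (f i) (sum-mono-≤ (f≤g ∘ punchIn i)) ⟩
  f i + sum (removeAt g i)  ∎))
  where open ≤-Reasoning

∑∑-diagonal : ∀ {n} (g : Fin n → Fin n → ℕ) → (∀ i j → i ≢ j → g i j ≡ 0) →
              ∑[ i < n ] ∑[ j < n ] g i j ≡ ∑[ i < n ] g i i
∑∑-diagonal {zero}  g off = refl
∑∑-diagonal {suc n} g off = sum-cong-≗ row
  where
  row : ∀ i → ∑[ j < suc n ] g i j ≡ g i i
  row i = begin
    ∑[ j < suc n ] g i j           ≡⟨ sum-remove {i = i} (g i) ⟩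
    g i i + sum (removeAt (g i) i) ≡⟨ cong (g i i +_) (sum-zero (λ j → off i _ (i≢punchIn j))) ⟩
    g i i + 0                      ≡⟨ +-identityʳ (g i i) ⟩
    g i i                          ∎
    where
    open ≡-Reasoning
    i≢punchIn : ∀ j → i ≢ punchIn i j
    i≢punchIn j = punchInᵢ≢i i j ∘ sym

∑-quadratic : ∀ {n} (m w : Fin n → ℕ) →
              2 * ∑[ i < n ] (m i * w i) ≤ ∑[ i < n ] (m i * m i * w i) + sum w
∑-quadratic {n} m w = begin
  2 * ∑[ i < n ] (m i * w i)         ≡⟨ *-distribˡ-sum 2 (λ i → m i * w i) ⟩
  ∑[ i < n ] (2 * (m i * w i))       ≤⟨ sum-mono-≤ pointwise ⟩
  ∑[ i < n ] (m i * m i * w i + w i) ≡⟨ ∑-distrib-+ (λ i → m i * m i * w i) w ⟩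
  ∑[ i < n ] (m i * m i * w i) + sum w ∎
  where
  open ≤-Reasoning
  pointwise : ∀ i → 2 * (m i * w i) ≤ m i * m i * w i + w i
  pointwise i = begin
    2 * (m i * w i)                ≡⟨ *-assoc 2 (m i) (w i) ⟨
    2 * m i * w i                  ≤⟨ *-monoˡ-≤ (w i) (2*m≤m*m+1 (m i)) ⟩
    (m i * m i + 1) * w i          ≡⟨ *-distribʳ-+ (w i) (m i * m i) 1 ⟩
    m i * m i * w i + 1 * w i      ≡⟨ cong (m i * m i * w i +_) (*-identityˡ (w i)) ⟩
    m i * m i * w i + w i          ∎

𝟙 : ∀ {p} {P : Set p} → Dec P → ℕ
𝟙 P? = if does P? then 1 else 0

module _ {p} {P : Set p} where

  𝟙≤1 : (P? : Dec P) → 𝟙 P? ≤ 1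
  𝟙≤1 (true  because _) = s≤s z≤n
  𝟙≤1 (false because _) = z≤n

  𝟙-idem : (P? : Dec P) → 𝟙 P? * 𝟙 P? ≡ 𝟙 P?
  𝟙-idem (true  because _) = refl
  𝟙-idem (false because _) = refl

  𝟙-yes : (P? : Dec P) → P → 𝟙 P? ≡ 1
  𝟙-yes (yes _)  _ = refl
  𝟙-yes (no ¬p)  p = ⊥-elim (¬p p)

  𝟙-no : (P? : Dec P) → ¬ P → 𝟙 P? ≡ 0
  𝟙-no (yes p) ¬p = ⊥-elim (¬p p)
  𝟙-no (no _)  _  = refl

  𝟙-×-dec : ∀ {q} {Q : Set q} (P? : Dec P) (Q? : Dec Q) → 𝟙 (P? ×-dec Q?) ≡ 𝟙 P? * 𝟙 Q?
  𝟙-×-dec (true  because _) (true  because _) = refl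
  𝟙-×-dec (true  because _) (false because _) = refl
  𝟙-×-dec (false because _) _                 = refl

length-filter≡∑𝟙 : ∀ {a p} {A : Set a} {P : A → Set p} (P? : Decidable P) (xs : List A) →
                   length (filter P? xs) ≡ ∑[ i < length xs ] 𝟙 (P? (lookup xs i))
length-filter≡∑𝟙 P? []       = refl
length-filter≡∑𝟙 P? (x ∷ xs) with does (P? x)
... | true  = cong suc (length-filter≡∑𝟙 P? xs)
... | false = length-filter≡∑𝟙 P? xs

∑𝟙≟ : ∀ {v} (a : Fin v) → ∑[ y < v ] 𝟙 (y ≟ a) ≡ 1
∑𝟙≟ {suc v} a = begin
  ∑[ y < suc v ] 𝟙 (y ≟ a)                    ≡⟨ sum-remove {i = a} (λ y → 𝟙 (y ≟ a)) ⟩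
  𝟙 (a ≟ a) + ∑[ j < v ] 𝟙 (punchIn a j ≟ a)  ≡⟨ cong₂ _+_ (𝟙-yes (a ≟ a) refl) punctured ⟩
  1 + 0                                       ∎
  where
  open ≡-Reasoning
  punctured : ∑[ j < v ] 𝟙 (punchIn a j ≟ a) ≡ 0
  punctured = sum-zero (λ j → 𝟙-no (punchIn a j ≟ a) (punchInᵢ≢i a j))

∑𝟙∈ : ∀ {v} {xs : List (Fin v)} → Unique xs → ∑[ y < v ] 𝟙 (∈?-gen _≟_ y xs) ≡ length xs
∑𝟙∈ {v} {[]}     []         = sum-replicate-zero v
∑𝟙∈ {v} {a ∷ xs} (a∉ ∷ xs!) = begin
  ∑[ y < v ] 𝟙 (∈?-gen _≟_ y (a ∷ xs))                   ≡⟨ sum-cong-≗ split ⟩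
  ∑[ y < v ] (𝟙 (y ≟ a) + 𝟙 (∈?-gen _≟_ y xs))          ≡⟨ ∑-distrib-+ (λ y → 𝟙 (y ≟ a)) _ ⟩
  ∑[ y < v ] 𝟙 (y ≟ a) + ∑[ y < v ] 𝟙 (∈?-gen _≟_ y xs) ≡⟨ cong₂ _+_ (∑𝟙≟ a) (∑𝟙∈ xs!) ⟩
  1 + length xs                                         ∎
  where
  open ≡-Reasoning
  split : ∀ y → 𝟙 (∈?-gen _≟_ y (a ∷ xs)) ≡ 𝟙 (y ≟ a) + 𝟙 (∈?-gen _≟_ y xs)
  split y with y ≟ a
  ... | yes refl = cong suc (sym (𝟙-no (∈?-gen _≟_ a xs) (All¬⇒¬Any {P = a ≡_} a∉)))
  ... | no _     = refl

𝟙K₃ 𝟙K₄ : ∀ {v} → Block v → ℕ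
𝟙K₃ b = [ const 1 , const 0 ] (size b)
𝟙K₄ b = [ const 0 , const 1 ] (size b)

𝟙K₃+𝟙K₄≡1 : ∀ {v} (b : Block v) → 𝟙K₃ b + 𝟙K₄ b ≡ 1
𝟙K₃+𝟙K₄≡1 (block _ _ (inj₁ _)) = refl
𝟙K₃+𝟙K₄≡1 (block _ _ (inj₂ _)) = refl

∣b∣*𝟙K₃ : ∀ {v} (b : Block v) → length (verts b) * 𝟙K₃ b ≡ 3 * 𝟙K₃ b
∣b∣*𝟙K₃ (block _  _ (inj₁ ∣b∣≡3)) = cong (_* 1) ∣b∣≡3
∣b∣*𝟙K₃ (block xs _ (inj₂ _))     = *-zeroʳ (length xs)

∣b∣*𝟙K₄ : ∀ {v} (b : Block v) → length (verts b) * 𝟙K₄ b ≡ 4 * 𝟙K₄ b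
∣b∣*𝟙K₄ (block xs _ (inj₁ _))     = *-zeroʳ (length xs)
∣b∣*𝟙K₄ (block _  _ (inj₂ ∣b∣≡4)) = cong (_* 1) ∣b∣≡4

module Incidences {v n : ℕ} (B : Fin n → Block v) where

  inc : Fin v → Fin n → ℕ
  inc x i = 𝟙 (∈?-gen _≟_ x (verts (B i)))

  inc≤1 : ∀ x i → inc x i ≤ 1
  inc≤1 x i = 𝟙≤1 (∈?-gen _≟_ x (verts (B i)))

  inc-idem : ∀ x i → inc x i * inc x i ≡ inc x i
  inc-idem x i = 𝟙-idem (∈?-gen _≟_ x (verts (B i)))

  through : Fin v → (Fin n → ℕ) → ℕ
  through x w = ∑[ i < n ] (inc x i * w i)

  meet : (Fin v → ℕ) → Fin n → ℕ
  meet u i = ∑[ y < v ] (u y * inc y i)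

  K₃ K₄ : Fin n → ℕ
  K₃ = 𝟙K₃ ∘ B
  K₄ = 𝟙K₄ ∘ B

  t f : ℕ
  t = sum K₃
  f = sum K₄

  r₃ r₄ : Fin v → ℕ
  r₃ x = through x K₃
  r₄ x = through x K₄

  pair pair₃ pair₄ : Fin v → Fin v → ℕ
  pair  x y = through y (inc x)
  pair₃ x y = through y (λ i → inc x i * K₃ i)
  pair₄ x y = through y (λ i → inc x i * K₄ i)

  open ≡-Reasoning

  double-counting : ∀ (u : Fin v → ℕ) (w : Fin n → ℕ) →
                    ∑[ y < v ] (u y * through y w) ≡ ∑[ i < n ] (meet u i * w i)
  double-counting u w = begin
    ∑[ y < v ] (u y * through y w)
      ≡⟨ sum-cong-≗ (λ y → *-distribˡ-sum (u y) (λ i → inc y i * w i)) ⟩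
    ∑[ y < v ] ∑[ i < n ] (u y * (inc y i * w i))
      ≡⟨ ∑-comm (λ y i → u y * (inc y i * w i)) ⟩
    ∑[ i < n ] ∑[ y < v ] (u y * (inc y i * w i))
      ≡⟨ sum-cong-≗ (λ i → sum-cong-≗ (λ y → *-assoc (u y) (inc y i) (w i))) ⟨
    ∑[ i < n ] ∑[ y < v ] (u y * inc y i * w i)
      ≡⟨ sum-cong-≗ (λ i → *-distribʳ-sum (w i) (λ y → u y * inc y i)) ⟨
    ∑[ i < n ] (meet u i * w i)
      ∎

  handshake : ∀ (w : Fin n → ℕ) → ∑[ y < v ] through y w ≡ ∑[ i < n ] (length (verts (B i)) * w i)
  handshake w = begin
    ∑[ y < v ] through y w                  ≡⟨ sum-cong-≗ (λ y → *-identityˡ (through y w)) ⟨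
    ∑[ y < v ] (1 * through y w)            ≡⟨ double-counting (const 1) w ⟩
    ∑[ i < n ] (meet (const 1) i * w i)     ≡⟨ sum-cong-≗ (λ i → cong (_* w i) (meet-1 i)) ⟩
    ∑[ i < n ] (length (verts (B i)) * w i) ∎
    where
    meet-1 : ∀ i → meet (const 1) i ≡ length (verts (B i))
    meet-1 i = trans (sum-cong-≗ (λ y → *-identityˡ (inc y i))) (∑𝟙∈ (unique (B i)))

  ∑-through : ∀ {k} {w : Fin n → ℕ} → (∀ i → length (verts (B i)) * w i ≡ k * w i) →
              ∑[ y < v ] through y w ≡ k * sum w
  ∑-through {k} {w} ∣B∣*w =
    trans (handshake w) (trans (sum-cong-≗ ∣B∣*w) (sym (*-distribˡ-sum k w)))

  ∣B∣*-scale : ∀ {k} {w : Fin n → ℕ} (c : Fin n → ℕ) →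
               (∀ i → length (verts (B i)) * w i ≡ k * w i) →
               ∀ i → length (verts (B i)) * (c i * w i) ≡ k * (c i * w i)
  ∣B∣*-scale {k} {w} c ∣B∣*w i = begin
    length (verts (B i)) * (c i * w i) ≡⟨ x∙yz≈y∙xz (length (verts (B i))) (c i) (w i) ⟩
    c i * (length (verts (B i)) * w i) ≡⟨ cong (c i *_) (∣B∣*w i) ⟩
    c i * (k * w i)                    ≡⟨ x∙yz≈y∙xz (c i) k (w i) ⟩
    k * (c i * w i)                    ∎

  ∑r₃≡3*t : ∑[ x < v ] r₃ x ≡ 3 * t
  ∑r₃≡3*t = ∑-through {3} {K₃} (∣b∣*𝟙K₃ ∘ B)

  ∑r₄≡4*f : ∑[ x < v ] r₄ x ≡ 4 * f
  ∑r₄≡4*f = ∑-through {4} {K₄} (∣b∣*𝟙K₄ ∘ B)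

  ∑pair₃≡3*r₃ : ∀ x → ∑[ y < v ] pair₃ x y ≡ 3 * r₃ x
  ∑pair₃≡3*r₃ x = ∑-through {3} {λ i → inc x i * K₃ i} (∣B∣*-scale {3} {K₃} (inc x) (∣b∣*𝟙K₃ ∘ B))

  ∑pair₄≡4*r₄ : ∀ x → ∑[ y < v ] pair₄ x y ≡ 4 * r₄ x
  ∑pair₄≡4*r₄ x = ∑-through {4} {λ i → inc x i * K₄ i} (∣B∣*-scale {4} {K₄} (inc x) (∣b∣*𝟙K₄ ∘ B))

  n≡t+f : n ≡ t + f
  n≡t+f = begin
    n                      ≡⟨ *-identityʳ n ⟨
    n * 1                  ≡⟨ ∑-const n 1 ⟨
    ∑[ i < n ] 1           ≡⟨ sum-cong-≗ (𝟙K₃+𝟙K₄≡1 ∘ B) ⟨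
    ∑[ i < n ] (K₃ i + K₄ i) ≡⟨ ∑-distrib-+ K₃ K₄ ⟩
    t + f                  ∎

  through-+ : ∀ x w w′ → through x (λ i → w i + w′ i) ≡ through x w + through x w′
  through-+ x w w′ = trans (sum-cong-≗ (λ i → *-distribˡ-+ (inc x i) (w i) (w′ i)))
                           (∑-distrib-+ (λ i → inc x i * w i) (λ i → inc x i * w′ i))

  through-mono : ∀ x {w w′ : Fin n → ℕ} → (∀ i → w i ≤ w′ i) → through x w ≤ through x w′
  through-mono x w≤w′ = sum-mono-≤ (λ i → *-monoʳ-≤ (inc x i) (w≤w′ i))

  through-idem : ∀ x w → through x (λ i → inc x i * w i) ≡ through x w
  through-idem x w =
    sum-cong-≗ (λ i → trans (sym (*-assoc (inc x i) _ _)) (cong (_* w i) (inc-idem x i)))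

  inc*≤ : ∀ x i m → inc x i * m ≤ m
  inc*≤ x i m = ≤-trans (*-monoˡ-≤ m (inc≤1 x i)) (≤-reflexive (+-identityʳ m))

  pair≡pair₃+pair₄ : ∀ x y → pair x y ≡ pair₃ x y + pair₄ x y
  pair≡pair₃+pair₄ x y = trans (sum-cong-≗ (λ i → cong (inc y i *_) (split i))) (through-+ y _ _)
    where
    split : ∀ i → inc x i ≡ inc x i * K₃ i + inc x i * K₄ i
    split i = begin
      inc x i                       ≡⟨ *-identityʳ (inc x i) ⟨
      inc x i * 1                   ≡⟨ cong (inc x i *_) (𝟙K₃+𝟙K₄≡1 (B i)) ⟨
      inc x i * (K₃ i + K₄ i)       ≡⟨ *-distribˡ-+ (inc x i) (K₃ i) (K₄ i) ⟩
      inc x i * K₃ i + inc x i * K₄ i ∎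

  pair₃≤pair : ∀ x y → pair₃ x y ≤ pair x y
  pair₃≤pair x y =
    ≤-trans (m≤m+n (pair₃ x y) (pair₄ x y)) (≤-reflexive (sym (pair≡pair₃+pair₄ x y)))

  pair₃≤r₃ : ∀ x y → pair₃ x y ≤ r₃ y
  pair₃≤r₃ x y = through-mono y (λ i → inc*≤ x i (K₃ i))

  ∑meet² : ∀ (u : Fin v → ℕ) (w : Fin n → ℕ) → ∑[ i < n ] (meet u i * meet u i * w i) ≡
                   ∑[ y < v ] (u y * ∑[ z < v ] (u z * through z (λ i → inc y i * w i)))
  ∑meet² u w = begin
    ∑[ i < n ] (m i * m i * w i)        ≡⟨ sum-cong-≗ (λ i → *-assoc (m i) (m i) (w i)) ⟩
    ∑[ i < n ] (m i * (m i * w i))      ≡⟨ sum-cong-≗ (λ i → cong (m i *_) (*-comm (m i) (w i))) ⟩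
    ∑[ i < n ] (m i * (w i * m i))      ≡⟨ double-counting u (λ i → w i * m i) ⟨
    ∑[ y < v ] (u y * through y (λ i → w i * m i)) ≡⟨ sum-cong-≗ (λ y → cong (u y *_) (inner y)) ⟩
    ∑[ y < v ] (u y * ∑[ z < v ] (u z * through z (λ i → inc y i * w i))) ∎
    where
    m : Fin n → ℕ
    m = meet u
    inner : ∀ y → through y (λ i → w i * m i) ≡ ∑[ z < v ] (u z * through z (λ i → inc y i * w i))
    inner y = begin
      ∑[ i < n ] (inc y i * (w i * m i)) ≡⟨ sum-cong-≗ (λ i → rearrange (inc y i) (w i) (m i)) ⟩
      ∑[ i < n ] (m i * (inc y i * w i)) ≡⟨ double-counting u (λ i → inc y i * w i) ⟨
      ∑[ z < v ] (u z * through z (λ i → inc y i * w i)) ∎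
      where
      rearrange : ∀ a b c → a * (b * c) ≡ c * (a * b)
      rearrange = solve-∀

module Decomposition {v : ℕ} (bs : List (Block (suc v))) (isDec : IsK34Decomposition bs) where

  open Incidences (lookup bs) public
  open ≤-Reasoning

  pair≡1 : ∀ {x y} → y ≢ x → pair x y ≡ 1
  pair≡1 {x} {y} y≢x = trans (sym coverCount≡pair) (isDec y x y≢x)
    where
    coverCount≡pair : coverCount bs y x ≡ pair x y
    coverCount≡pair = trans (length-filter≡∑𝟙 _ bs) (sum-cong-≗ (λ i → 𝟙-×-dec (y∈? i) (x∈? i)))
      where
      x∈? y∈? : ∀ i → Dec _
      x∈? i = ∈?-gen _≟_ x (verts (lookup bs i))
      y∈? i = ∈?-gen _≟_ y (verts (lookup bs i))

  pair-diag : ∀ x → pair x x ≡ r₃ x + r₄ x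
  pair-diag x = trans (pair≡pair₃+pair₄ x x) (cong₂ _+_ (through-idem x K₃) (through-idem x K₄))

  degree : ∀ x → 2 * r₃ x + 3 * r₄ x ≡ v
  degree x = +-cancelˡ-≡ (r₃ x + r₄ x) _ _ (begin-equality
    r₃ x + r₄ x + (2 * r₃ x + 3 * r₄ x)
      ≡⟨ regroup (r₃ x) (r₄ x) ⟩
    3 * r₃ x + 4 * r₄ x
      ≡⟨ cong₂ _+_ (∑pair₃≡3*r₃ x) (∑pair₄≡4*r₄ x) ⟨
    ∑[ y < suc v ] pair₃ x y + ∑[ y < suc v ] pair₄ x y
      ≡⟨ ∑-distrib-+ (pair₃ x) (pair₄ x) ⟨
    ∑[ y < suc v ] (pair₃ x y + pair₄ x y)
      ≡⟨ sum-cong-≗ (pair≡pair₃+pair₄ x) ⟨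
    ∑[ y < suc v ] pair x y
      ≡⟨ sum-remove {i = x} (pair x) ⟩
    pair x x + sum (removeAt (pair x) x)
      ≡⟨ cong₂ _+_ (pair-diag x) punctured ⟩
    r₃ x + r₄ x + v
      ∎)
    where
    regroup : ∀ a b → a + b + (2 * a + 3 * b) ≡ 3 * a + 4 * b
    regroup = solve-∀
    punctured : sum (removeAt (pair x) x) ≡ v
    punctured =
      trans (sum-cong-≗ (λ j → pair≡1 (punchInᵢ≢i x j))) (trans (∑-const v 1) (*-identityʳ v))

  edge-count : 6 * (t + 2 * f) ≡ suc v * v
  edge-count = begin-equality
    6 * (t + 2 * f)
      ≡⟨ regroup t f ⟩
    2 * (3 * t) + 3 * (4 * f)
      ≡⟨ cong₂ (λ a b → 2 * a + 3 * b) ∑r₃≡3*t ∑r₄≡4*f ⟨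
    2 * sum r₃ + 3 * sum r₄
      ≡⟨ cong₂ _+_ (*-distribˡ-sum 2 r₃) (*-distribˡ-sum 3 r₄) ⟩
    ∑[ x < suc v ] (2 * r₃ x) + ∑[ x < suc v ] (3 * r₄ x)
      ≡⟨ ∑-distrib-+ (λ x → 2 * r₃ x) (λ x → 3 * r₄ x) ⟨
    ∑[ x < suc v ] (2 * r₃ x + 3 * r₄ x)
      ≡⟨ sum-cong-≗ degree ⟩
    ∑[ x < suc v ] v
      ≡⟨ ∑-const (suc v) v ⟩
    suc v * v
      ∎
    where
    regroup : ∀ a b → 6 * (a + 2 * b) ≡ 2 * (3 * a) + 3 * (4 * b)
    regroup = solve-∀

  onTriangle : Fin (suc v) → ℕ
  onTriangle x = 1 ⊓ r₃ x

  triangleVertices : ℕ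
  triangleVertices = sum onTriangle

  pair₃≤onTriangle : ∀ {x y} → y ≢ x → pair₃ x y ≤ onTriangle y
  pair₃≤onTriangle {x} {y} y≢x =
    ⊓-glb (≤-trans (pair₃≤pair x y) (≤-reflexive (pair≡1 y≢x))) (pair₃≤r₃ x y)

  punctured-pair₃ : ∀ x → sum (removeAt (pair₃ x) x) ≡ 2 * r₃ x
  punctured-pair₃ x = +-cancelˡ-≡ (r₃ x) _ _ (begin-equality
    r₃ x + sum (removeAt (pair₃ x) x)      ≡⟨ cong (_+ sum-off) (through-idem x K₃) ⟨
    pair₃ x x + sum (removeAt (pair₃ x) x) ≡⟨ sum-remove {i = x} (pair₃ x) ⟨
    ∑[ y < suc v ] pair₃ x y               ≡⟨ ∑pair₃≡3*r₃ x ⟩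
    3 * r₃ x                               ≡⟨ regroup (r₃ x) ⟩
    r₃ x + 2 * r₃ x                        ∎)
    where
    sum-off : ℕ
    sum-off = sum (removeAt (pair₃ x) x)
    regroup : ∀ a → 3 * a ≡ a + 2 * a
    regroup = solve-∀

  onTriangle+2*r₃≤triangleVertices : ∀ x → onTriangle x + 2 * r₃ x ≤ triangleVertices
  onTriangle+2*r₃≤triangleVertices x = begin
    onTriangle x + 2 * r₃ x
      ≡⟨ cong (onTriangle x +_) (punctured-pair₃ x) ⟨
    onTriangle x + sum (removeAt (pair₃ x) x)
      ≤⟨ +-monoʳ-≤ (onTriangle x) (sum-mono-≤ (λ j → pair₃≤onTriangle (punchInᵢ≢i x j))) ⟩
    onTriangle x + sum (removeAt onTriangle x)
      ≡⟨ sum-remove {i = x} onTriangle ⟨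
    triangleVertices
      ∎

  3∣r₃ : 3 ∣ v → ∀ x → 3 ∣ r₃ x
  3∣r₃ 3∣v x = coprime-divisor (from-yes (coprime? 3 2)) (∣m+n∣m⇒∣n 3∣3r₄+2r₃ (m∣m*n (r₄ x)))
    where
    3∣3r₄+2r₃ : 3 ∣ 3 * r₄ x + 2 * r₃ x
    3∣3r₄+2r₃ = subst (3 ∣_) (sym (trans (+-comm (3 * r₄ x) (2 * r₃ x)) (degree x))) 3∣v

  7≤triangleVertices : 3 ∣ v → ∀ {x} → r₃ x ≢ 0 → 7 ≤ triangleVertices
  7≤triangleVertices 3∣v {x} r₃x≢0 = begin
    7                       ≤⟨ s≤s (*-monoʳ-≤ 2 (∣⇒≤ ⦃ ≢-nonZero r₃x≢0 ⦄ (3∣r₃ 3∣v x))) ⟩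
    1 + 2 * r₃ x            ≡⟨ cong (_+ 2 * r₃ x) (1⊓-nonzero r₃x≢0) ⟨
    onTriangle x + 2 * r₃ x ≤⟨ onTriangle+2*r₃≤triangleVertices x ⟩
    triangleVertices        ∎

  triangleVertices≤t : 3 ∣ v → triangleVertices ≤ t
  triangleVertices≤t 3∣v = *-cancelˡ-≤ 3 (begin
    3 * triangleVertices              ≡⟨ *-distribˡ-sum 3 onTriangle ⟩
    ∑[ x < suc v ] (3 * onTriangle x) ≤⟨ sum-mono-≤ (λ x → ∣⇒*[1⊓]≤ (3∣r₃ 3∣v x)) ⟩
    sum r₃                            ≡⟨ ∑r₃≡3*t ⟩
    3 * t                             ∎)

  pair₄≡0 : ∀ {x y} → y ≢ x → r₃ y ≢ 0 → sum (removeAt onTriangle x) ≤ 2 * r₃ x →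
            pair₄ x y ≡ 0
  pair₄≡0 {x} {y} y≢x r₃y≢0 saturated = suc-injective (begin-equality
    1 + pair₄ x y         ≡⟨ cong (_+ pair₄ x y) pair₃≡1 ⟨
    pair₃ x y + pair₄ x y ≡⟨ pair≡pair₃+pair₄ x y ⟨
    pair x y              ≡⟨ pair≡1 y≢x ⟩
    1                     ∎)
    where
    pair₃≗onTriangle : ∀ j → pair₃ x (punchIn x j) ≡ onTriangle (punchIn x j)
    pair₃≗onTriangle = sum-mono-≤-tight (λ j → pair₃≤onTriangle (punchInᵢ≢i x j))
      (≤-trans saturated (≤-reflexive (sym (punctured-pair₃ x))))
    j : Fin v
    j = punchOut (y≢x ∘ sym)
    y≡punchIn : punchIn x j ≡ y
    y≡punchIn = punchIn-punchOut (y≢x ∘ sym)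
    pair₃≡1 : pair₃ x y ≡ 1
    pair₃≡1 = begin-equality
      pair₃ x y                  ≡⟨ cong (pair₃ x) y≡punchIn ⟨
      pair₃ x (punchIn x j)      ≡⟨ pair₃≗onTriangle j ⟩
      onTriangle (punchIn x j)   ≡⟨ cong onTriangle y≡punchIn ⟩
      onTriangle y               ≡⟨ 1⊓-nonzero r₃y≢0 ⟩
      1                          ∎

module K₁₉ (bs : List (Block 19)) (isDec : IsK34Decomposition bs) where

  open Decomposition bs isDec public

  3∣18 : 3 ∣ 18
  3∣18 = divides 6 refl

  t+2f≡57 : t + 2 * f ≡ 57
  t+2f≡57 = *-cancelˡ-≡ (t + 2 * f) 57 6 edge-count

  2*|bs|≡t+57 : 2 * length bs ≡ t + 57
  2*|bs|≡t+57 = trans (cong (2 *_) n≡t+f) (trans (regroup t f) (cong (t +_) t+2f≡57))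
    where
    regroup : ∀ a b → 2 * (a + b) ≡ a + (a + 2 * b)
    regroup = solve-∀

  t≢0 : t ≢ 0
  t≢0 t≡0 = from-no (2 ∣? 57) (subst (2 ∣_) (trans (cong (_+ 2 * f) (sym t≡0)) t+2f≡57) (m∣m*n f))

  triangle-vertex : ∃ λ x → r₃ x ≢ 0
  triangle-vertex = ∃-nonzero r₃ (t≢0 ∘ *-cancelˡ-≡ t 0 3 ∘ trans (sym ∑r₃≡3*t))

  7≤t : 7 ≤ t
  7≤t = ≤-trans (7≤triangleVertices 3∣18 (proj₂ triangle-vertex)) (triangleVertices≤t 3∣18)

  module SevenTriangles (t≡7 : t ≡ 7) where

    open ≤-Reasoning

    f≡25 : f ≡ 25
    f≡25 = *-cancelˡ-≡ f 25 2 (+-cancelˡ-≡ 7 _ _ (trans (cong (_+ 2 * f) (sym t≡7)) t+2f≡57))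

    triangleVertices≡7 : triangleVertices ≡ 7
    triangleVertices≡7 = ≤-antisym (subst (triangleVertices ≤_) t≡7 (triangleVertices≤t 3∣18))
                                   (7≤triangleVertices 3∣18 (proj₂ triangle-vertex))

    3*onTriangle≗r₃ : ∀ y → 3 * onTriangle y ≡ r₃ y
    3*onTriangle≗r₃ = sum-mono-≤-tight (λ y → ∣⇒*[1⊓]≤ (3∣r₃ 3∣18 y)) (begin
      sum r₃                          ≡⟨ ∑r₃≡3*t ⟩
      3 * t                           ≡⟨ cong (3 *_) (trans t≡7 (sym triangleVertices≡7)) ⟩
      3 * triangleVertices            ≡⟨ *-distribˡ-sum 3 onTriangle ⟩
      ∑[ y < 19 ] (3 * onTriangle y)  ∎)

    r₃≡3 : ∀ {y} → r₃ y ≢ 0 → r₃ y ≡ 3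
    r₃≡3 {y} r₃y≢0 = trans (sym (3*onTriangle≗r₃ y)) (cong (3 *_) (1⊓-nonzero r₃y≢0))

    r₄≡4 : ∀ {y} → r₃ y ≢ 0 → r₄ y ≡ 4
    r₄≡4 {y} r₃y≢0 = *-cancelˡ-≡ (r₄ y) 4 3
      (+-cancelˡ-≡ 6 _ _ (trans (cong (λ a → 2 * a + 3 * r₄ y) (sym (r₃≡3 r₃y≢0))) (degree y)))

    saturated : ∀ {x} → r₃ x ≢ 0 → sum (removeAt onTriangle x) ≤ 2 * r₃ x
    saturated {x} r₃x≢0 = +-cancelˡ-≤ 1 _ _ (begin
      1 + sum (removeAt onTriangle x)            ≡⟨ cong (_+ sum-off) (1⊓-nonzero r₃x≢0) ⟨
      onTriangle x + sum (removeAt onTriangle x) ≡⟨ sum-remove {i = x} onTriangle ⟨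
      triangleVertices                           ≡⟨ triangleVertices≡7 ⟩
      1 + 2 * 3                                  ≡⟨ cong (λ a → 1 + 2 * a) (r₃≡3 r₃x≢0) ⟨
      1 + 2 * r₃ x                               ∎)
      where
      sum-off : ℕ
      sum-off = sum (removeAt onTriangle x)

    u : Fin 19 → ℕ
    u = onTriangle

    first-moment : ∑[ i < length bs ] (meet u i * K₄ i) ≡ 28
    first-moment = begin-equality
      ∑[ i < length bs ] (meet u i * K₄ i) ≡⟨ double-counting u K₄ ⟨
      ∑[ y < 19 ] (u y * r₄ y)             ≡⟨ sum-cong-≗ (λ y → 1⊓-*-cong (r₃ y) r₄≡4) ⟩
      ∑[ y < 19 ] (u y * 4)                ≡⟨ *-distribʳ-sum 4 u ⟨
      triangleVertices * 4                 ≡⟨ cong (_* 4) triangleVertices≡7 ⟩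
      28                                   ∎

    off-diagonal : ∀ y z → y ≢ z → u y * (u z * pair₄ y z) ≡ 0
    off-diagonal y z y≢z = begin-equality
      u y * (u z * pair₄ y z) ≡⟨ 1⊓-*-cong (r₃ y) (λ r₃y≢0 → 1⊓-*-cong (r₃ z) (λ r₃z≢0 →
                                   pair₄≡0 (y≢z ∘ sym) r₃z≢0 (saturated r₃y≢0))) ⟩
      u y * (u z * 0)         ≡⟨ cong (u y *_) (*-zeroʳ (u z)) ⟩
      u y * 0                 ≡⟨ *-zeroʳ (u y) ⟩
      0                       ∎

    second-moment : ∑[ i < length bs ] (meet u i * meet u i * K₄ i) ≡ 28
    second-moment = begin-equality
      ∑[ i < length bs ] (meet u i * meet u i * K₄ i)
        ≡⟨ ∑meet² u K₄ ⟩
      ∑[ y < 19 ] (u y * ∑[ z < 19 ] (u z * pair₄ y z))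
        ≡⟨ sum-cong-≗ (λ y → *-distribˡ-sum (u y) (λ z → u z * pair₄ y z)) ⟩
      ∑[ y < 19 ] ∑[ z < 19 ] (u y * (u z * pair₄ y z))
        ≡⟨ ∑∑-diagonal (λ y z → u y * (u z * pair₄ y z)) off-diagonal ⟩
      ∑[ y < 19 ] (u y * (u y * pair₄ y y))
        ≡⟨ sum-cong-≗ diagonal ⟩
      ∑[ y < 19 ] (u y * r₄ y)
        ≡⟨ double-counting u K₄ ⟩
      ∑[ i < length bs ] (meet u i * K₄ i)
        ≡⟨ first-moment ⟩
      28
        ∎
      where
      diagonal : ∀ y → u y * (u y * pair₄ y y) ≡ u y * r₄ y
      diagonal y = begin-equality
        u y * (u y * pair₄ y y) ≡⟨ *-assoc (u y) (u y) (pair₄ y y) ⟨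
        u y * u y * pair₄ y y   ≡⟨ cong₂ _*_ (1⊓-idem (r₃ y)) (through-idem y K₄) ⟩
        u y * r₄ y              ∎

    absurd : ⊥
    absurd = from-no (56 ℕ.≤? 53) (begin
      2 * 28                                              ≡⟨ cong (2 *_) first-moment ⟨
      2 * ∑[ i < length bs ] (meet u i * K₄ i)            ≤⟨ ∑-quadratic (meet u) K₄ ⟩
      ∑[ i < length bs ] (meet u i * meet u i * K₄ i) + f ≡⟨ cong₂ _+_ second-moment f≡25 ⟩
      28 + 25                                             ∎)

  t≢7 : t ≢ 7
  t≢7 = SevenTriangles.absurd

lemma29 : (bs : List (Block 19)) → IsK34Decomposition bs → 33 ≤ length bs
lemma29 bs isDec = ≮⇒≥ (λ |bs|<33 → t≢7 (≤-antisym (t≤7 |bs|<33) 7≤t))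
  where
  open K₁₉ bs isDec
  open ≤-Reasoning
  t≤7 : length bs < 33 → t ≤ 7
  t≤7 |bs|<33 = +-cancelʳ-≤ 57 t 7 (begin
    t + 57         ≡⟨ 2*|bs|≡t+57 ⟨
    2 * length bs  ≤⟨ *-monoʳ-≤ 2 (≤-pred |bs|<33) ⟩
    64             ∎)
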